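{- Every inescapable group is a Burnside group. That is, if $(G,S)$ is an inescapable tape graph, then every element of $G$ has finite order.
   Context: A tape graph $(G,S)$ consists of an infinite group $G$ together with a finite generating set $S\subseteq G$ that is closed under inverses. It is called inescapable if the following holds: for every computable infinite sequence $(s_0,s_1,\ldots)$ of elements of $S$, there are indices $0\le i\le j$ with $s_is_{i+1}\cdots s_j=e$ in $G$. Equivalently, the path $e,\ s_0,\ s_0s_1,\ldots$ in the Cayley graph self-intersects. Here a sequence is computable if some Turing machine, on input $k$, outputs $s_k$. A Burnside group is an infinite group in which every element has finite order. -}

module Defs where

open import Level using (Level; _⊔_)
open import Data.Nat using (ℕ; zero; suc; _+_; _∸_; _≤_; _<_)
open import Data.Fin using (Fin; toℕ)
open import Data.Vec using (Vec; []; _∷_; lookup)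
open import Data.List using (List; []; _∷_; foldr; map)
open import Data.Product using (Σ; ∃; _×_; _,_)
open import Relation.Nullary using (¬_)
open import Algebra.Bundles using (Group)

-- Model of computation: Kleene's partial recursive (μ-recursive)
-- functions, with a big-step evaluation relation.  (Equivalent to Turing
-- machine computability.)

data PR : ℕ → Set where
  zer  : ∀ {n} → PR n
  succ : PR 1
  proj : ∀ {n} → Fin n → PR n
  comp : ∀ {m n} → PR m → Vec (PR n) m → PR n
  prec : ∀ {n} → PR n → PR (suc (suc n)) → PR (suc n)
  mu   : ∀ {n} → PR (suc n) → PR n

mutual
  data Eval : ∀ {n} → PR n → Vec ℕ n → ℕ → Set where
    e-zer  : ∀ {n} {xs : Vec ℕ n} → Eval zer xs 0
    e-succ : ∀ {x} → Eval succ (x ∷ []) (suc x)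
    e-proj : ∀ {n} {i : Fin n} {xs : Vec ℕ n} → Eval (proj i) xs (lookup xs i)
    e-comp : ∀ {m n} {f : PR m} {gs : Vec (PR n) m} {xs : Vec ℕ n}
               {ys : Vec ℕ m} {z : ℕ} →
             EvalVec gs xs ys → Eval f ys z → Eval (comp f gs) xs z
    e-prec-z : ∀ {n} {f : PR n} {g : PR (suc (suc n))} {xs : Vec ℕ n} {z} →
               Eval f xs z → Eval (prec f g) (0 ∷ xs) z
    e-prec-s : ∀ {n} {f : PR n} {g : PR (suc (suc n))} {xs : Vec ℕ n} {k r z} →
               Eval (prec f g) (k ∷ xs) r → Eval g (k ∷ r ∷ xs) z →
               Eval (prec f g) (suc k ∷ xs) z
    e-mu   : ∀ {n} {f : PR (suc n)} {xs : Vec ℕ n} {y} →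
             Eval f (y ∷ xs) 0 →
             (∀ z → z < y → ∃ λ v → Eval f (z ∷ xs) (suc v)) →
             Eval (mu f) xs y

  data EvalVec : ∀ {m n} → Vec (PR n) m → Vec ℕ n → Vec ℕ m → Set where
    ev-[] : ∀ {n} {xs : Vec ℕ n} → EvalVec [] xs []
    ev-∷  : ∀ {m n} {g : PR n} {gs : Vec (PR n) m} {xs : Vec ℕ n} {y ys} →
            Eval g xs y → EvalVec gs xs ys → EvalVec (g ∷ gs) xs (y ∷ ys)

Computable : ∀ {k} → (ℕ → Fin k) → Set
Computable s = Σ (PR 1) λ p → ∀ i → Eval p (i ∷ []) (toℕ (s i))

module _ {c ℓ : Level} (G : Group c ℓ) where
  open Group G

  IsFinite : Set (c ⊔ ℓ)
  IsFinite = ∃ λ n → Σ (Fin n → Carrier) λ e → ∀ g → ∃ λ i → g ≈ e i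

  IsInfinite : Set (c ⊔ ℓ)
  IsInfinite = ¬ IsFinite

  wordProd : ∀ {k} → (Fin k → Carrier) → List (Fin k) → Carrier
  wordProd gen = foldr (λ a r → gen a ∙ r) ε

  -- the family gen generates G (as a group; since it is closed under
  -- inverses, monoid-generation is the same)
  Generates : ∀ {k} → (Fin k → Carrier) → Set (c ⊔ ℓ)
  Generates {k} gen = ∀ g → ∃ λ (w : List (Fin k)) → g ≈ wordProd gen w

  ClosedUnderInverses : ∀ {k} → (Fin k → Carrier) → Set ℓ
  ClosedUnderInverses {k} gen = ∀ (i : Fin k) → ∃ λ j → gen j ≈ gen i ⁻¹

  IsTapeGraph : ∀ {k} → (Fin k → Carrier) → Set (c ⊔ ℓ)
  IsTapeGraph gen = IsInfinite × Generates gen × ClosedUnderInverses gen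

  segment : ∀ {k} → (ℕ → Fin k) → ℕ → ℕ → List (Fin k)
  segment s i zero    = s i ∷ []
  segment s i (suc l) = s i ∷ segment s (suc i) l

  Inescapable : ∀ {k} → (Fin k → Carrier) → Set (c ⊔ ℓ)
  Inescapable {k} gen =
    IsTapeGraph gen ×
    (∀ (s : ℕ → Fin k) → Computable s →
       ∃ λ i → ∃ λ j → i ≤ j × wordProd gen (segment s i (j ∸ i)) ≈ ε)

  pow : Carrier → ℕ → Carrier
  pow g zero    = ε
  pow g (suc n) = g ∙ pow g n

  HasFiniteOrder : Carrier → Set ℓ
  HasFiniteOrder g = ∃ λ n → 0 < n × pow g n ≈ ε

  IsBurnside : Set (c ⊔ ℓ)
  IsBurnside = IsInfinite × (∀ g → HasFiniteOrder g)

-- Induction on the length of a word w.  The periodic sequence w w w … is computable, so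
-- inescapability yields a nonempty stretch of it with trivial product.  Replacing w by a
-- rotation only conjugates its product h, so we may assume the stretch starts at the
-- beginning of a period; it then spells q copies of w followed by a proper prefix of w
-- with product t, so hᵠ t = 1.  If the prefix is empty, hᵠ = 1 with q > 0; if q = 0,
-- then t = 1 and h is the product of the shorter word left after deleting the prefix;
-- otherwise t has finite order by induction, hence so has hᵠ = t⁻¹.
module Submission where

open import Defs
open import Algebra.Bundles using (Group)
open import Data.Fin using (Fin; toℕ; zero; suc)
open import Data.List using (List; []; _∷_; _++_; [_]; length; applyUpTo; take; drop)
open import Data.List.Properties
  using (++-assoc; ++-identityʳ; ∷-injective; length-++; length-take; length-drop; take++drop≡id)
open import Data.List.NonEmpty as List⁺ using (List⁺; _∷_; head; tail; toList; _∷ʳ_)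
open import Data.List.NonEmpty.Properties using (∷→∷⁺)
open import Data.Nat using (ℕ; zero; suc; _+_; _*_; _∸_; _≤_; _<_; z≤n; s≤s)
open import Data.Nat.Properties
  using (+-comm; +-assoc; ≤-refl; ≤-reflexive; ≤-trans; <⇒≤; ≤-<-trans; <-≤-trans; m≤n⇒m<n∨m≡n; m≤n⇒m⊓n≡m; m⊓n≤m; m∸n≤m)
open import Data.Nat.DivMod using (_%_; _/_; m≡m%n+[m/n]*n; m%n<n; n%n≡0; m<n⇒m%n≡m)
open import Data.Nat.GeneralisedArithmetic using (iterate; fold)
open import Data.Product using (∃; _×_; _,_; proj₂)
open import Data.Sum using (inj₁; inj₂)
open import Data.Vec using ([]; _∷_)
open import Function using (_∘_; id)
open import Relation.Binary.PropositionalEquality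
  using (_≡_; _≗_; cong; cong₂; subst; module ≡-Reasoning)
import Relation.Binary.PropositionalEquality as ≡

-- Sequences produced by finite automata are computable

constant : ℕ → PR 0
constant zero    = zer
constant (suc c) = comp succ (constant c ∷ [])

eval-constant : ∀ c → Eval (constant c) [] c
eval-constant zero    = e-zer
eval-constant (suc c) = e-comp (ev-∷ (eval-constant c) ev-[]) e-succ

tableLookup : List ℕ → ℕ → ℕ
tableLookup []       _       = 0
tableLookup (c ∷ cs) zero    = c
tableLookup (c ∷ cs) (suc x) = tableLookup cs x

tableLookup-applyUpTo : ∀ (f : ℕ → ℕ) {m r} → r < m → tableLookup (applyUpTo f m) r ≡ f r
tableLookup-applyUpTo f {suc m} {zero}  _         = ≡.refl
tableLookup-applyUpTo f {suc m} {suc r} (s≤s r<m) = tableLookup-applyUpTo (f ∘ suc) r<m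

table : List ℕ → PR 1
table []       = zer
table (c ∷ cs) = prec (constant c) (comp (table cs) (proj zero ∷ []))

eval-table : ∀ cs x → Eval (table cs) (x ∷ []) (tableLookup cs x)
eval-table []       x       = e-zer
eval-table (c ∷ cs) zero    = e-prec-z (eval-constant c)
eval-table (c ∷ cs) (suc x) =
  e-prec-s (eval-table (c ∷ cs) x) (e-comp (ev-∷ e-proj ev-[]) (eval-table cs x))

computable-resp-≗ : ∀ {k} {s t : ℕ → Fin k} → s ≗ t → Computable s → Computable t
computable-resp-≗ s≗t (p , eval-p) =
  p , λ i → subst (λ y → Eval p (i ∷ []) (toℕ y)) (s≗t i) (eval-p i)

fold-preserves : ∀ {A : Set} (P : A → Set) {z s} → P z → (∀ {x} → P x → P (s x)) → ∀ n → P (fold z s n)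
fold-preserves P Pz Ps zero    = Pz
fold-preserves P Pz Ps (suc n) = Ps (fold-preserves P Pz Ps n)

automatic-computable : ∀ {m k} (step : ℕ → ℕ) (out : ℕ → Fin k) →
                       0 < m → (∀ {r} → r < m → step r < m) → Computable (out ∘ fold 0 step)
automatic-computable {m} step out 0<m step-< =
  comp (table (applyUpTo (toℕ ∘ out) m)) (stateProgram ∷ []) ,
  λ n → e-comp (ev-∷ (eval-state n) ev-[]) (eval-lookup (toℕ ∘ out) n)
  where
  state-< : ∀ n → fold 0 step n < m
  state-< = fold-preserves (_< m) 0<m step-<

  eval-lookup : ∀ f n → Eval (table (applyUpTo f m)) (fold 0 step n ∷ []) (f (fold 0 step n))
  eval-lookup f n = subst (Eval _ _) (tableLookup-applyUpTo f (state-< n)) (eval-table _ _)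

  stateProgram : PR 1
  stateProgram = prec zer (comp (table (applyUpTo step m)) (proj (suc zero) ∷ []))

  eval-state : ∀ n → Eval stateProgram (n ∷ []) (fold 0 step n)
  eval-state zero    = e-prec-z e-zer
  eval-state (suc n) = e-prec-s (eval-state n) (e-comp (ev-∷ e-proj ev-[]) (eval-lookup step n))

module _ {A : Set} where

  rotate : List⁺ A → List⁺ A
  rotate (x ∷ xs) = xs ∷ʳ x

  cycle : List⁺ A → ℕ → A
  cycle u n = head (iterate rotate u n)

  iterate-suc : ∀ (f : A → A) x n → iterate f x (suc n) ≡ f (iterate f x n)
  iterate-suc f x zero    = ≡.refl
  iterate-suc f x (suc n) = iterate-suc f (f x) n

  toList-rotate : ∀ u → toList (rotate u) ≡ tail u ++ [ head u ]
  toList-rotate (x ∷ [])     = ≡.refl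
  toList-rotate (x ∷ y ∷ ys) = ≡.refl

  toList-injective : ∀ {u v : List⁺ A} → toList u ≡ toList v → u ≡ v
  toList-injective {_ ∷ _} {_ ∷ _} = ∷→∷⁺

  length-iterate-rotate : ∀ u n → List⁺.length (iterate rotate u n) ≡ List⁺.length u
  length-iterate-rotate u zero    = ≡.refl
  length-iterate-rotate u (suc n) = ≡.trans (length-iterate-rotate (rotate u) n) length-rotate
    where
    length-rotate : List⁺.length (rotate u) ≡ List⁺.length u
    length-rotate =
      ≡.trans (cong length (toList-rotate u)) (≡.trans (length-++ (tail u)) (+-comm _ 1))

  toList-rotate-∷ : ∀ {u x a b} → toList u ≡ x ∷ a ++ b →
                    head u ≡ x × toList (rotate u) ≡ a ++ b ++ [ x ]
  toList-rotate-∷ {u} {x} {a} {b} eq with ∷-injective eq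
  ... | head≡x , tail≡a++b = head≡x , (begin
    toList (rotate u)         ≡⟨ toList-rotate u ⟩
    tail u ++ [ head u ]      ≡⟨ cong₂ (λ t h → t ++ [ h ]) tail≡a++b head≡x ⟩
    (a ++ b) ++ [ x ]         ≡⟨ ++-assoc a b [ x ] ⟩
    a ++ b ++ [ x ]           ∎)
    where open ≡-Reasoning

  applyUpTo-cycle-prefix : ∀ a {b} u → toList u ≡ a ++ b → applyUpTo (cycle u) (length a) ≡ a
  applyUpTo-cycle-prefix []      u eq = ≡.refl
  applyUpTo-cycle-prefix (x ∷ a) u eq with toList-rotate-∷ {u} {a = a} eq
  ... | head≡x , eq′ = cong₂ _∷_ head≡x (applyUpTo-cycle-prefix a (rotate u) eq′)

  toList-iterate-rotate : ∀ a {b} u → toList u ≡ a ++ b → toList (iterate rotate u (length a)) ≡ b ++ a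
  toList-iterate-rotate []      {b} u eq = ≡.trans eq (≡.sym (++-identityʳ b))
  toList-iterate-rotate (x ∷ a) {b} u eq =
    ≡.trans (toList-iterate-rotate a (rotate u) (proj₂ (toList-rotate-∷ {u} {a = a} eq)))
            (++-assoc b [ x ] a)

  iterate-rotate-length : ∀ u → iterate rotate u (List⁺.length u) ≡ u
  iterate-rotate-length u =
    toList-injective (toList-iterate-rotate (toList u) u (≡.sym (++-identityʳ (toList u))))

  applyUpTo-cycle-+ : ∀ i n u → applyUpTo (cycle u) (i + n) ≡
                                applyUpTo (cycle u) i ++ applyUpTo (cycle (iterate rotate u i)) n
  applyUpTo-cycle-+ zero    n u = ≡.refl
  applyUpTo-cycle-+ (suc i) n u = cong (head u ∷_) (applyUpTo-cycle-+ i n (rotate u))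

  applyUpTo-cycle-period : ∀ u n →
                           applyUpTo (cycle u) (List⁺.length u + n) ≡ toList u ++ applyUpTo (cycle u) n
  applyUpTo-cycle-period u n = begin
    applyUpTo (cycle u) (m + n)                                       ≡⟨ applyUpTo-cycle-+ m n u ⟩
    applyUpTo (cycle u) m ++ applyUpTo (cycle (iterate rotate u m)) n ≡⟨ cong₂ _++_ whole period ⟩
    toList u ++ applyUpTo (cycle u) n                                 ∎
    where
    open ≡-Reasoning
    m = List⁺.length u
    whole : applyUpTo (cycle u) m ≡ toList u
    whole = applyUpTo-cycle-prefix (toList u) u (≡.sym (++-identityʳ (toList u)))
    period : applyUpTo (cycle (iterate rotate u m)) n ≡ applyUpTo (cycle u) n
    period = cong (λ v → applyUpTo (cycle v) n) (iterate-rotate-length u)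

  applyUpTo-cycle-take : ∀ u {p} → p ≤ List⁺.length u → applyUpTo (cycle u) p ≡ take p (toList u)
  applyUpTo-cycle-take u {p} p≤m =
    subst (λ n → applyUpTo (cycle u) n ≡ take p (toList u))
          (≡.trans (length-take p (toList u)) (m≤n⇒m⊓n≡m p≤m))
          (applyUpTo-cycle-prefix (take p (toList u)) u (≡.sym (take++drop≡id p (toList u))))

-- Position n of the periodic sequence only depends on n mod m, which an automaton
-- with m states can track.
cycle-computable : ∀ {k} (u : List⁺ (Fin k)) → Computable (cycle u)
cycle-computable u =
  computable-resp-≗ (λ n → cong head (≡.sym (rotations-mod n)))
                    (automatic-computable step (cycle u) 0<m step-<)
  where
  m = List⁺.length u

  0<m : 0 < m
  0<m = s≤s z≤n

  step : ℕ → ℕ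
  step r = suc r % m

  step-< : ∀ {r} → r < m → step r < m
  step-< {r} _ = m%n<n (suc r) m

  rotate-wrap : ∀ {r} → r < m → iterate rotate u (suc r) ≡ iterate rotate u (step r)
  rotate-wrap {r} r<m with m≤n⇒m<n∨m≡n r<m
  ... | inj₁ 1+r<m = cong (iterate rotate u) (≡.sym (m<n⇒m%n≡m 1+r<m))
  ... | inj₂ 1+r≡m = begin
    iterate rotate u (suc r)   ≡⟨ cong (iterate rotate u) 1+r≡m ⟩
    iterate rotate u m         ≡⟨ iterate-rotate-length u ⟩
    u                          ≡⟨ cong (iterate rotate u) (≡.sym step-r≡0) ⟩
    iterate rotate u (step r)  ∎
    where
    open ≡-Reasoning
    step-r≡0 : step r ≡ 0
    step-r≡0 = ≡.trans (cong (_% m) 1+r≡m) (n%n≡0 m)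

  rotations-mod : ∀ n → iterate rotate u n ≡ iterate rotate u (fold 0 step n)
  rotations-mod zero    = ≡.refl
  rotations-mod (suc n) = begin
    iterate rotate u (suc n)     ≡⟨ iterate-suc rotate u n ⟩
    rotate (iterate rotate u n)  ≡⟨ cong rotate (rotations-mod n) ⟩
    rotate (iterate rotate u r)  ≡⟨ ≡.sym (iterate-suc rotate u r) ⟩
    iterate rotate u (suc r)     ≡⟨ rotate-wrap (fold-preserves (_< m) 0<m step-< n) ⟩
    iterate rotate u (step r)    ∎
    where
    open ≡-Reasoning
    r = fold 0 step n

module _ {c ℓ} (G : Group c ℓ) where
  open Group G
  open import Algebra.Properties.Group G
    using (inverseˡ-unique; ⁻¹-anti-homo-∙; ε⁻¹≈ε; identityˡ-unique)
  open import Relation.Binary.Reasoning.Setoid setoid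

  pow-cong : ∀ {x y} n → x ≈ y → pow G x n ≈ pow G y n
  pow-cong zero    x≈y = refl
  pow-cong (suc n) x≈y = ∙-cong x≈y (pow-cong n x≈y)

  pow-+ : ∀ x m n → pow G x (m + n) ≈ pow G x m ∙ pow G x n
  pow-+ x zero    n = sym (identityˡ _)
  pow-+ x (suc m) n = trans (∙-congˡ (pow-+ x m n)) (sym (assoc _ _ _))

  pow-* : ∀ x m n → pow G x (m * n) ≈ pow G (pow G x n) m
  pow-* x zero    n = refl
  pow-* x (suc m) n = trans (pow-+ x n (m * n)) (∙-congˡ (pow-* x m n))

  hasFiniteOrder-resp-≈ : ∀ {x y} → x ≈ y → HasFiniteOrder G x → HasFiniteOrder G y
  hasFiniteOrder-resp-≈ x≈y (n , 0<n , xⁿ≈ε) = n , 0<n , trans (pow-cong n (sym x≈y)) xⁿ≈ε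

  pow-comm : ∀ x n → pow G x n ∙ x ≈ x ∙ pow G x n
  pow-comm x zero    = trans (identityˡ x) (sym (identityʳ x))
  pow-comm x (suc n) = trans (assoc _ _ _) (∙-congˡ (pow-comm x n))

  pow-∙-comm : ∀ x y n → y ∙ pow G (x ∙ y) n ≈ pow G (y ∙ x) n ∙ y
  pow-∙-comm x y zero    = trans (identityʳ y) (sym (identityˡ y))
  pow-∙-comm x y (suc n) = begin
    y ∙ ((x ∙ y) ∙ pow G (x ∙ y) n)   ≈⟨ ∙-congˡ (assoc _ _ _) ⟩
    y ∙ (x ∙ (y ∙ pow G (x ∙ y) n))   ≈⟨ ∙-congˡ (∙-congˡ (pow-∙-comm x y n)) ⟩
    y ∙ (x ∙ (pow G (y ∙ x) n ∙ y))   ≈⟨ sym (assoc _ _ _) ⟩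
    (y ∙ x) ∙ (pow G (y ∙ x) n ∙ y)   ≈⟨ sym (assoc _ _ _) ⟩
    ((y ∙ x) ∙ pow G (y ∙ x) n) ∙ y   ∎

  pow-⁻¹ : ∀ x n → pow G (x ⁻¹) n ≈ pow G x n ⁻¹
  pow-⁻¹ x zero    = sym ε⁻¹≈ε
  pow-⁻¹ x (suc n) = begin
    x ⁻¹ ∙ pow G (x ⁻¹) n     ≈⟨ ∙-congˡ (pow-⁻¹ x n) ⟩
    x ⁻¹ ∙ pow G x n ⁻¹       ≈⟨ sym (⁻¹-anti-homo-∙ (pow G x n) x) ⟩
    (pow G x n ∙ x) ⁻¹        ≈⟨ ⁻¹-cong (pow-comm x n) ⟩
    (x ∙ pow G x n) ⁻¹        ∎

  hasFiniteOrder-∙-comm : ∀ {x y} → HasFiniteOrder G (x ∙ y) → HasFiniteOrder G (y ∙ x)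
  hasFiniteOrder-∙-comm {x} {y} (n , 0<n , [xy]ⁿ≈ε) = n , 0<n , identityˡ-unique _ y (begin
    pow G (y ∙ x) n ∙ y   ≈⟨ sym (pow-∙-comm x y n) ⟩
    y ∙ pow G (x ∙ y) n   ≈⟨ ∙-congˡ [xy]ⁿ≈ε ⟩
    y ∙ ε                 ≈⟨ identityʳ y ⟩
    y                     ∎)

  hasFiniteOrder-⁻¹ : ∀ {x} → HasFiniteOrder G x → HasFiniteOrder G (x ⁻¹)
  hasFiniteOrder-⁻¹ {x} (n , 0<n , xⁿ≈ε) = n , 0<n , trans (pow-⁻¹ x n) (trans (⁻¹-cong xⁿ≈ε) ε⁻¹≈ε)

  hasFiniteOrder-inverseˡ : ∀ {x y} → x ∙ y ≈ ε → HasFiniteOrder G y → HasFiniteOrder G x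
  hasFiniteOrder-inverseˡ {x} {y} xy≈ε =
    hasFiniteOrder-resp-≈ (sym (inverseˡ-unique x y xy≈ε)) ∘ hasFiniteOrder-⁻¹

  pow-hasFiniteOrder⇒hasFiniteOrder : ∀ {x} q → 0 < q → HasFiniteOrder G (pow G x q) →
                                      HasFiniteOrder G x
  pow-hasFiniteOrder⇒hasFiniteOrder {x} (suc q) _ (suc n , _ , [xᵠ]ⁿ≈ε) =
    suc n * suc q , s≤s z≤n , trans (pow-* x (suc n) (suc q)) [xᵠ]ⁿ≈ε

  segment-suc : ∀ {k} (s : ℕ → Fin k) i l → segment G s (suc i) l ≡ segment G (s ∘ suc) i l
  segment-suc s i zero    = ≡.refl
  segment-suc s i (suc l) = cong (s (suc i) ∷_) (segment-suc s (suc i) l)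

  segment-zero : ∀ {k} (s : ℕ → Fin k) l → segment G s 0 l ≡ applyUpTo s (suc l)
  segment-zero s zero    = ≡.refl
  segment-zero s (suc l) = cong (s 0 ∷_) (≡.trans (segment-suc s 0 l) (segment-zero (s ∘ suc) l))

  segment-cycle : ∀ {k} i l (u : List⁺ (Fin k)) →
                  segment G (cycle u) i l ≡ applyUpTo (cycle (iterate rotate u i)) (suc l)
  segment-cycle zero    l u = segment-zero (cycle u) l
  segment-cycle (suc i) l u = ≡.trans (segment-suc (cycle u) i l) (segment-cycle i l (rotate u))

  module _ {k} (gen : Fin k → Carrier) where

    prod : List (Fin k) → Carrier
    prod = wordProd G gen

    prod-++ : ∀ u v → prod (u ++ v) ≈ prod u ∙ prod v
    prod-++ []      v = sym (identityˡ _)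
    prod-++ (a ∷ u) v = trans (∙-congˡ (prod-++ u v)) (sym (assoc _ _ _))

    hasFiniteOrder-rotate : ∀ u → HasFiniteOrder G (prod (toList (rotate u))) →
                            HasFiniteOrder G (prod (toList u))
    hasFiniteOrder-rotate u@(x ∷ xs) = hasFiniteOrder-∙-comm ∘ hasFiniteOrder-resp-≈ (begin
      prod (toList (rotate u))  ≡⟨ cong prod (toList-rotate u) ⟩
      prod (xs ++ [ x ])        ≈⟨ prod-++ xs [ x ] ⟩
      prod xs ∙ (gen x ∙ ε)     ≈⟨ ∙-congˡ (identityʳ _) ⟩
      prod xs ∙ gen x           ∎)

    hasFiniteOrder-iterate-rotate : ∀ u n → HasFiniteOrder G (prod (toList (iterate rotate u n))) →
                                    HasFiniteOrder G (prod (toList u))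
    hasFiniteOrder-iterate-rotate u zero    = id
    hasFiniteOrder-iterate-rotate u (suc n) =
      hasFiniteOrder-rotate u ∘ hasFiniteOrder-iterate-rotate (rotate u) n

    prod-applyUpTo-cycle : ∀ v q {p} → p ≤ List⁺.length v →
                           prod (applyUpTo (cycle v) (q * List⁺.length v + p)) ≈
                           pow G (prod (toList v)) q ∙ prod (take p (toList v))
    prod-applyUpTo-cycle v zero    {p} p≤m = begin
      prod (applyUpTo (cycle v) p)  ≡⟨ cong prod (applyUpTo-cycle-take v p≤m) ⟩
      prod (take p (toList v))      ≈⟨ sym (identityˡ _) ⟩
      ε ∙ prod (take p (toList v))  ∎
    prod-applyUpTo-cycle v (suc q) {p} p≤m = begin
      prod (applyUpTo (cycle v) (m + q * m + p))          ≡⟨ cong (prod ∘ applyUpTo (cycle v)) (+-assoc m _ p) ⟩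
      prod (applyUpTo (cycle v) (m + (q * m + p)))        ≡⟨ cong prod (applyUpTo-cycle-period v _) ⟩
      prod (toList v ++ applyUpTo (cycle v) (q * m + p))  ≈⟨ prod-++ (toList v) _ ⟩
      h ∙ prod (applyUpTo (cycle v) (q * m + p))          ≈⟨ ∙-congˡ (prod-applyUpTo-cycle v q p≤m) ⟩
      h ∙ (pow G h q ∙ prod (take p (toList v)))          ≈⟨ sym (assoc _ _ _) ⟩
      pow G h (suc q) ∙ prod (take p (toList v))          ∎
      where
      m = List⁺.length v
      h = prod (toList v)

    ShorterWordsHaveFiniteOrder : ℕ → Set ℓ
    ShorterWordsHaveFiniteOrder n = ∀ w → length w < n → HasFiniteOrder G (prod w)

    pow∙prefix≈ε⇒hasFiniteOrder : ∀ w q p → ShorterWordsHaveFiniteOrder (length w) →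
                                  p < length w → 0 < q + p → pow G (prod w) q ∙ prod (take p w) ≈ ε →
                                  HasFiniteOrder G (prod w)
    pow∙prefix≈ε⇒hasFiniteOrder w       (suc q) zero    _       _      _ rel =
      suc q , s≤s z≤n , trans (sym (identityʳ _)) rel
    pow∙prefix≈ε⇒hasFiniteOrder (x ∷ w) zero    (suc p) shorter _      _ rel =
      hasFiniteOrder-resp-≈ (sym prod≈rest) (shorter rest (s≤s |rest|≤|w|))
      where
      prefix = take (suc p) (x ∷ w)
      rest   = drop p w
      prod≈rest : prod (x ∷ w) ≈ prod rest
      prod≈rest = begin
        prod (x ∷ w)             ≡⟨ cong prod (≡.sym (take++drop≡id (suc p) (x ∷ w))) ⟩
        prod (prefix ++ rest)    ≈⟨ prod-++ prefix rest ⟩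
        prod prefix ∙ prod rest  ≈⟨ ∙-congʳ (trans (sym (identityˡ _)) rel) ⟩
        ε ∙ prod rest            ≈⟨ identityˡ _ ⟩
        prod rest                ∎
      |rest|≤|w| : length rest ≤ length w
      |rest|≤|w| = ≤-trans (≤-reflexive (length-drop p w)) (m∸n≤m _ p)
    pow∙prefix≈ε⇒hasFiniteOrder w       (suc q) (suc p) shorter p<|w| _ rel =
      pow-hasFiniteOrder⇒hasFiniteOrder (suc q) (s≤s z≤n)
        (hasFiniteOrder-inverseˡ rel (shorter prefix |prefix|<|w|))
      where
      prefix = take (suc p) w
      |prefix|<|w| : length prefix < length w
      |prefix|<|w| = ≤-<-trans (≤-trans (≤-reflexive (length-take (suc p) w)) (m⊓n≤m _ _)) p<|w|

    cycle-prefix≈ε⇒hasFiniteOrder : ∀ v l → ShorterWordsHaveFiniteOrder (List⁺.length v) →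
                                    prod (applyUpTo (cycle v) (suc l)) ≈ ε →
                                    HasFiniteOrder G (prod (toList v))
    cycle-prefix≈ε⇒hasFiniteOrder v l shorter closed =
      pow∙prefix≈ε⇒hasFiniteOrder (toList v) q p shorter p<m (nonempty q p walk-length) relation
      where
      m = List⁺.length v
      q = suc l / m
      p = suc l % m

      p<m : p < m
      p<m = m%n<n (suc l) m

      walk-length : q * m + p ≡ suc l
      walk-length = ≡.trans (+-comm (q * m) p) (≡.sym (m≡m%n+[m/n]*n (suc l) m))

      nonempty : ∀ a b → a * m + b ≡ suc l → 0 < a + b
      nonempty zero    zero    ()
      nonempty zero    (suc b) _ = s≤s z≤n
      nonempty (suc a) b       _ = s≤s z≤n

      relation : pow G (prod (toList v)) q ∙ prod (take p (toList v)) ≈ ε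
      relation = begin
        pow G (prod (toList v)) q ∙ prod (take p (toList v))  ≈⟨ prod-applyUpTo-cycle v q (<⇒≤ p<m) ⟨
        prod (applyUpTo (cycle v) (q * m + p))                ≡⟨ cong (prod ∘ applyUpTo (cycle v)) walk-length ⟩
        prod (applyUpTo (cycle v) (suc l))                    ≈⟨ closed ⟩
        ε                                                     ∎

    module _ (escape : ∀ (s : ℕ → Fin k) → Computable s →
                       ∃ λ i → ∃ λ j → i ≤ j × prod (segment G s i (j ∸ i)) ≈ ε) where

      hasFiniteOrder-word : ∀ w → ShorterWordsHaveFiniteOrder (length w) → HasFiniteOrder G (prod w)
      hasFiniteOrder-word []       _       = 1 , s≤s z≤n , identityʳ ε
      hasFiniteOrder-word (x ∷ xs) shorter with escape (cycle (x ∷ xs)) (cycle-computable (x ∷ xs))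
      -- The stretch has j ∸ i + 1 letters whatever i and j are.
      ... | i , j , _ , closed =
        hasFiniteOrder-iterate-rotate u i (cycle-prefix≈ε⇒hasFiniteOrder v (j ∸ i) shorter′ closed′)
        where
        u : List⁺ (Fin k)
        u = x ∷ xs
        v = iterate rotate u i

        shorter′ : ShorterWordsHaveFiniteOrder (List⁺.length v)
        shorter′ = subst ShorterWordsHaveFiniteOrder (≡.sym (length-iterate-rotate u i)) shorter

        closed′ : prod (applyUpTo (cycle v) (suc (j ∸ i))) ≈ ε
        closed′ = trans (reflexive (cong prod (≡.sym (segment-cycle i (j ∸ i) u)))) closed

      wordsHaveFiniteOrder : ∀ n → ShorterWordsHaveFiniteOrder n
      wordsHaveFiniteOrder (suc n) w (s≤s |w|≤n) =
        hasFiniteOrder-word w (λ w′ |w′|<|w| → wordsHaveFiniteOrder n w′ (<-≤-trans |w′|<|w| |w|≤n))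

mainTheorem9 : ∀ {c ℓ} (G : Group c ℓ) (k : ℕ) (gen : Fin k → Group.Carrier G) →
                 Inescapable G gen → IsBurnside G
mainTheorem9 G k gen ((infinite , generates , _) , escape) = infinite , λ g →
  let w , g≈w = generates g in
  hasFiniteOrder-resp-≈ G (Group.sym G g≈w)
    (wordsHaveFiniteOrder G gen escape (suc (length w)) w ≤-refl)
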